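{- Let $G^+=(V,E^+)$ be a finite simple undirected graph, let $\phi\ge 0$ and $0\le\eta<1$, and suppose that $\mathrm{OPT}\le\phi$. Then Algorithm ClusterPhi$(G^+,\phi,\eta)$ outputs a clustering $\mathcal{C}$ of $V$ with $\mathrm{obj}(\mathcal{C})\le(3+\eta)\phi$. This holds for every execution, i.e., for every choice of the pivots $u_i$, every ordering of the components, and every admissible answer of the similarity queries.
   Context: For $u\in V$, $N(u)$ is the set of neighbours of $u$ in $G^+$, $\deg(u)=|N(u)|$, and $N[u]=N(u)\cup\{u\}$. $A\,\Delta\,B$ denotes the symmetric difference. Clustering and objective. A clustering $\mathcal{C}$ is a partition of $V$, and $\mathcal{C}_u$ denotes the cluster containing $u$. The disagreement of $u$ is $\rho_{\mathcal{C}}(u)=|N[u]\,\Delta\,\mathcal{C}_u|$, and $\mathrm{obj}(\mathcal{C})=\max_{u\in V}\rho_{\mathcal{C}}(u)$. $\mathrm{OPT}$ is the minimum of $\mathrm{obj}(\mathcal{C})$ over all clusterings. Similarity query. For $\eta'\ge0$ and $t\ge0$, an $\eta'$-similarity query $\Delta_{\eta'}(u,v,t)$ returns a value as follows: - it returns $0$ if $|N[u]\Delta N[v]|>(1+\eta')t$; - it returns $1$ if $|N[u]\Delta N[v]|\le t$; - it returns either $0$ or $1$ (arbitrarily) otherwise. Algorithm ClusterPhi$(G^+,\phi,\eta)$: 1. Let $E'$ be the set of pairs $\{u,v\}$ of vertices for which $\Delta_\eta(u,v,2\phi)$ returns $1$. 2. Let $V_{\mathrm{low}}=\{w:\deg(w)\le(3+\eta)\phi\}$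 and $V_{\mathrm{high}}=V\setminus V_{\mathrm{low}}$. Set $V_1=V_{\mathrm{low}}$. 3. Let $\mathcal{L}=\{L_1,\dots,L_k\}$ be the connected components of the graph $(V_{\mathrm{high}},E')$, in any order. 4. For $i=1,\dots,k$: - choose any $u_i\in L_i$; - let $R(u_i)=\{w\in V_i\cap N(u_i): \Delta_{\eta/2}(w,u_i,2\phi)\text{ returns }1\}$; - set $C_i=L_i\cup R(u_i)$ and $V_{i+1}=V_i\setminus R(u_i)$. 5. If for some $i$ some $u\in C_i$ has $|N[u]\Delta C_i|>(3+\eta)\phi$, return "$\mathrm{OPT}>\phi$". 6. Otherwise return $\mathcal{C}=\{C_1,\dots,C_k\}\cup\{\{v\}:v\in V_{k+1}\}$.
   Formalization: The parameters φ and η are rational. -}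

module Defs where

open import Data.Nat using (ℕ)
open import Data.Bool using (Bool; true; false; _∧_; _∨_; not; if_then_else_)
open import Data.Integer using (+_)
open import Data.Rational using (ℚ; _/_; _+_; _*_; _≤_; _<_; _≤ᵇ_; ½; 1ℚ)
open import Data.Fin using (Fin)
open import Data.Fin.Subset as S using (Subset; ⁅_⁆; _∪_; _∩_; _─_; ∣_∣)
open import Data.Vec using (tabulate; lookup; zipWith)
open import Data.List using (List; []; _∷_; _++_; map; filter; allFin; length)
open import Data.Bool.ListAction using (any)
import Data.List as L
open import Data.List.Membership.Propositional as LM using ()
open import Data.Product using (_×_; _,_; Σ; ∃; proj₁; proj₂)
open import Data.Maybe using (Maybe; just; nothing)
open import Relation.Binary.PropositionalEquality using (_≡_)
open import Relation.Nullary using (¬_)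

record Graph (n : ℕ) : Set where
  field
    adj       : Fin n → Fin n → Bool
    adj-sym   : ∀ u v → adj u v ≡ adj v u
    adj-irrefl : ∀ u → adj u u ≡ false
open Graph public

module _ {n : ℕ} (G : Graph n) where

  N : Fin n → Subset n
  N u = tabulate (adj G u)

  N[_] : Fin n → Subset n
  N[ u ] = ⁅ u ⁆ ∪ N u

  deg : Fin n → ℕ
  deg u = ∣ N u ∣

_Δ_ : ∀ {n} → Subset n → Subset n → Subset n
A Δ B = (A ─ B) ∪ (B ─ A)

⟦_⟧ : ℕ → ℚ
⟦ m ⟧ = + m / 1

_<ᵇ_ : ℚ → ℚ → Bool
a <ᵇ b = not (b ≤ᵇ a)

module _ {n : ℕ} where

  IsClustering : List (Subset n) → Set
  IsClustering Cs =
      (∀ {C} → C LM.∈ Cs → S.Nonempty C)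
    × (∀ v → ∃ λ C → C LM.∈ Cs × v S.∈ C)
    × (∀ (i j : Fin (length Cs)) v → v S.∈ L.lookup Cs i → v S.∈ L.lookup Cs j → i ≡ j)

  ρ : Graph n → Fin n → Subset n → ℕ
  ρ G u C = ∣ N[_] G u Δ C ∣

  ObjLe : Graph n → List (Subset n) → ℚ → Set
  ObjLe G Cs b = ∀ {C} → C LM.∈ Cs → ∀ u → u S.∈ C → ⟦ ρ G u C ⟧ ≤ b

  OPT≤ : Graph n → ℚ → Set
  OPT≤ G φ = ∃ λ Cs → IsClustering Cs × ObjLe G Cs φ

-- Similarity queries: an answer table q (q u v = answer of Δ_η'(u,v,t))
-- is admissible if it obeys the specification for every pair.

  IsQuery : Graph n → ℚ → ℚ → (Fin n → Fin n → Bool) → Set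
  IsQuery G η' t q = ∀ u v →
      (⟦ ∣ N[_] G u Δ N[_] G v ∣ ⟧ ≤ t → q u v ≡ true)
    × ((1ℚ + η') * t < ⟦ ∣ N[_] G u Δ N[_] G v ∣ ⟧ → q u v ≡ false)

module ClusterPhi {n : ℕ} (G : Graph n) (φ η : ℚ) where

  twoφ : ℚ
  twoφ = ⟦ 2 ⟧ * φ

  bound : ℚ
  bound = (⟦ 3 ⟧ + η) * φ

  high : Fin n → Bool
  high w = bound <ᵇ ⟦ deg G w ⟧

  Vhigh : Subset n
  Vhigh = tabulate high

  Vlow : Subset n
  Vlow = tabulate (λ w → not (high w))

  -- connectivity in the graph (V_high, E'), E' = {u,v} with q1 u v = true
  data Conn (q1 : Fin n → Fin n → Bool) : Fin n → Fin n → Set where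
    conn-refl : ∀ {v} → v S.∈ Vhigh → Conn q1 v v
    conn-step : ∀ {u v w} → Conn q1 u v → w S.∈ Vhigh → q1 v w ≡ true → Conn q1 u w

  -- an execution choice: the list of components L₁,…,L_k in some order,
  -- each paired with its chosen pivot u_i.
  ValidExec : (Fin n → Fin n → Bool) → List (Subset n × Fin n) → Set
  ValidExec q1 exec =
      (∀ {L u} → (L , u) LM.∈ exec → u S.∈ L)
    × (∀ {L u} → (L , u) LM.∈ exec → ∀ v → v S.∈ L → v S.∈ Vhigh)
    × (∀ {L u} → (L , u) LM.∈ exec → ∀ v w → v S.∈ L → w S.∈ L → Conn q1 v w)
    × (∀ {L u} → (L , u) LM.∈ exec → ∀ v w → v S.∈ L → Conn q1 v w → w S.∈ L)
    × (∀ v → v S.∈ Vhigh → ∃ λ L → ∃ λ u → (L , u) LM.∈ exec × v S.∈ L)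
    × (∀ (i j : Fin (length Ls)) v →
         v S.∈ L.lookup Ls i → v S.∈ L.lookup Ls j → i ≡ j)
    where Ls = map proj₁ exec

  module _ (q2 : Fin n → Fin n → Bool) where
    -- R(u) relative to the current remaining set V_i;
    -- q2 w u is the answer of Δ_{η/2}(w,u,2φ)
    R : Fin n → Subset n → Subset n
    R u Vi = tabulate (λ w → lookup Vi w ∧ adj G u w ∧ q2 w u)

    loop : Subset n → List (Subset n × Fin n) → List (Subset n) × Subset n
    loop Vi [] = [] , Vi
    loop Vi ((L , u) ∷ rest) with loop (Vi ─ R u Vi) rest
    ... | Cs , Vk = (L ∪ R u Vi) ∷ Cs , Vk

    bad : Subset n → Bool
    bad C = any (λ u → lookup C u ∧ (bound <ᵇ ⟦ ∣ N[_] G u Δ C ∣ ⟧)) (allFin n)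

    singletons : Subset n → List (Subset n)
    singletons Vk = map ⁅_⁆ (filter (λ v → lookup Vk v Data.Bool.≟ true) (allFin n))
      where import Data.Bool

    -- output: nothing = "OPT > φ", just 𝒞 = the clustering
    clusterPhi : List (Subset n × Fin n) → Maybe (List (Subset n))
    clusterPhi exec with loop Vlow exec
    ... | Cs , Vk = if any bad Cs then nothing else just (Cs ++ singletons Vk)

{-# OPTIONS --safe #-}

-- Fix an optimal clustering 𝒪 with objective at most φ.  By the triangle inequality for
-- |_ Δ _|, two vertices of one 𝒪-cluster have |N[x] Δ N[y]| ≤ 2φ; conversely, if h and y
-- have degree > (3+η)φ and lie in different (disjoint) 𝒪-clusters, counting degrees gives
-- |N[x] Δ N[y]| > (1+η)2φ for every x in the cluster of h.  So every component L of
-- (V_high, E') consists of the high vertices of one 𝒪-cluster 𝒪(u); a low vertex of 𝒪(u)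
-- is never taken by an earlier R(u′), and if it is adjacent to u it lands in R(u).  Hence
-- C = L ∪ R(u) lies between N[u] ∩ 𝒪(u) and N[u] ∪ 𝒪(u), so C is within ρ(u) ≤ φ of both
-- N[u] and 𝒪(u); going through 𝒪(u) bounds ρ(x) for x ∈ L by 2φ, going through N[u] bounds
-- it for x ∈ R(u) by (1+η/2)2φ + φ = (3+η)φ.  Leftover vertices are low, and a singleton
-- {w} has disagreement deg(w) ≤ (3+η)φ.  In particular the test of step 5 never fires.

module Submission where

open import Defs
open import Data.Nat using (ℕ)
open import Data.Bool using (Bool)
open import Data.Fin using (Fin)
open import Data.Fin.Subset using (Subset)
open import Data.List using (List)
open import Data.Product using (_×_; ∃)
open import Data.Maybe using (just)
open import Data.Rational using (ℚ)
open import Relation.Binary.PropositionalEquality using (_≡_)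

module Subsets where

  open import Data.Nat using (suc; z≤n; s≤s; _≤_; _+_; _*_)
  open import Data.Nat.Properties using (≤-trans; ≤-reflexive; +-suc; +-comm; +-assoc; *-suc; +-monoʳ-≤; *-monoʳ-≤; n≤1+n; module ≤-Reasoning)
  open import Data.Bool using (true; false; not)
  open import Data.Vec using (_∷_; []; tabulate; here; there)
  open import Data.Vec.Properties using (lookup∘tabulate; []=⇒lookup; lookup⇒[]=)
  open import Data.Fin.Subset using (_∈_; _∉_; _⊆_; _∪_; _∩_; _─_; ∣_∣; inside; outside)
  open import Data.Fin.Subset.Properties using (x∈p∪q⁻; x∈p∪q⁺; x∈p∩q⁻; x∈p∩q⁺; p─q⊆p; x∈p∧x∉q⇒x∈p─q; ∪-comm; ∩-comm; _∈?_; p⊆q⇒∣p∣≤∣q∣)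
  open import Data.Product using (_,_; uncurry)
  open import Data.Sum using (_⊎_; inj₁; inj₂; [_,_]′)
  import Data.Sum as Sum
  open import Data.Empty using (⊥)
  open import Function using (_∘_; id)
  open import Relation.Nullary using (yes; no; contradiction)
  open import Relation.Binary.PropositionalEquality using (refl; sym; trans; cong; subst; module ≡-Reasoning)

  private
    variable
      n : ℕ
      x : Fin n
      p q r : Subset n

  Disjoint : Subset n → Subset n → Set
  Disjoint p q = ∀ {x} → x ∈ p → x ∈ q → ⊥

  x∈tabulate⁺ : ∀ {f : Fin n → Bool} → f x ≡ true → x ∈ tabulate f
  x∈tabulate⁺ {x = x} {f} fx = lookup⇒[]= x (tabulate f) (trans (lookup∘tabulate f x) fx)

  x∈tabulate⁻ : ∀ {f : Fin n → Bool} → x ∈ tabulate f → f x ≡ true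
  x∈tabulate⁻ {x = x} {f} x∈ = trans (sym (lookup∘tabulate f x)) ([]=⇒lookup x∈)

  x∈tabulate⊎x∈tabulate[not] : ∀ (f : Fin n → Bool) x → x ∈ tabulate f ⊎ x ∈ tabulate (not ∘ f)
  x∈tabulate⊎x∈tabulate[not] f x = by-value (f x) refl
    where
    by-value : ∀ b → f x ≡ b → x ∈ tabulate f ⊎ x ∈ tabulate (not ∘ f)
    by-value true  fx≡true  = inj₁ (x∈tabulate⁺ fx≡true)
    by-value false fx≡false = inj₂ (x∈tabulate⁺ (cong not fx≡false))

  x∈p─q⇒x∉q : ∀ (p q : Subset n) → x ∈ p ─ q → x ∉ q
  x∈p─q⇒x∉q (_ ∷ p) (inside ∷ q) () here
  x∈p─q⇒x∉q (_ ∷ p) (_ ∷ q) (there x∈) (there x∈q) = x∈p─q⇒x∉q p q x∈ x∈q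

  x∈pΔq⁻ : ∀ (p q : Subset n) → x ∈ p Δ q → (x ∈ p × x ∉ q) ⊎ (x ∈ q × x ∉ p)
  x∈pΔq⁻ p q x∈ = Sum.map (λ h → p─q⊆p p q h , x∈p─q⇒x∉q p q h) (λ h → p─q⊆p q p h , x∈p─q⇒x∉q q p h)
                          (x∈p∪q⁻ (p ─ q) (q ─ p) x∈)

  x∈pΔq⁺ : (x ∈ p × x ∉ q) ⊎ (x ∈ q × x ∉ p) → x ∈ p Δ q
  x∈pΔq⁺ = x∈p∪q⁺ ∘ Sum.map (uncurry x∈p∧x∉q⇒x∈p─q) (uncurry x∈p∧x∉q⇒x∈p─q)

  Δ-comm : ∀ (p q : Subset n) → p Δ q ≡ q Δ p
  Δ-comm p q = ∪-comm (p ─ q) (q ─ p)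

  ∣p∪q∣≤∣p∣+∣q∣ : ∀ (p q : Subset n) → ∣ p ∪ q ∣ ≤ ∣ p ∣ + ∣ q ∣
  ∣p∪q∣≤∣p∣+∣q∣ []            []            = z≤n
  ∣p∪q∣≤∣p∣+∣q∣ (outside ∷ p) (outside ∷ q) = ∣p∪q∣≤∣p∣+∣q∣ p q
  ∣p∪q∣≤∣p∣+∣q∣ (outside ∷ p) (inside  ∷ q) = ≤-trans (s≤s (∣p∪q∣≤∣p∣+∣q∣ p q)) (≤-reflexive (sym (+-suc ∣ p ∣ ∣ q ∣)))
  ∣p∪q∣≤∣p∣+∣q∣ (inside  ∷ p) (outside ∷ q) = s≤s (∣p∪q∣≤∣p∣+∣q∣ p q)
  ∣p∪q∣≤∣p∣+∣q∣ (inside  ∷ p) (inside  ∷ q) = s≤s (≤-trans (∣p∪q∣≤∣p∣+∣q∣ p q) (+-monoʳ-≤ ∣ p ∣ (n≤1+n ∣ q ∣)))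

  pΔq⊆pΔr∪rΔq : ∀ (p q r : Subset n) → p Δ q ⊆ p Δ r ∪ r Δ q
  pΔq⊆pΔr∪rΔq p q r {x} x∈pΔq with x ∈? r | x∈pΔq⁻ p q x∈pΔq
  ... | yes x∈r | inj₁ (_   , x∉q) = x∈p∪q⁺ (inj₂ (x∈pΔq⁺ (inj₁ (x∈r , x∉q))))
  ... | no  x∉r | inj₁ (x∈p , _  ) = x∈p∪q⁺ (inj₁ (x∈pΔq⁺ (inj₁ (x∈p , x∉r))))
  ... | yes x∈r | inj₂ (_   , x∉p) = x∈p∪q⁺ (inj₁ (x∈pΔq⁺ (inj₂ (x∈r , x∉p))))
  ... | no  x∉r | inj₂ (x∈q , _  ) = x∈p∪q⁺ (inj₂ (x∈pΔq⁺ (inj₂ (x∈q , x∉r))))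

  ∣pΔq∣≤∣pΔr∣+∣rΔq∣ : ∀ (p q r : Subset n) → ∣ p Δ q ∣ ≤ ∣ p Δ r ∣ + ∣ r Δ q ∣
  ∣pΔq∣≤∣pΔr∣+∣rΔq∣ p q r = ≤-trans (p⊆q⇒∣p∣≤∣q∣ (pΔq⊆pΔr∪rΔq p q r)) (∣p∪q∣≤∣p∣+∣q∣ (p Δ r) (r Δ q))

  ∣p∣≤∣pΔq∣+∣q∣ : ∀ (p q : Subset n) → ∣ p ∣ ≤ ∣ p Δ q ∣ + ∣ q ∣
  ∣p∣≤∣pΔq∣+∣q∣ p q = ≤-trans (p⊆q⇒∣p∣≤∣q∣ p⊆pΔq∪q) (∣p∪q∣≤∣p∣+∣q∣ (p Δ q) q)
    where
    p⊆pΔq∪q : p ⊆ p Δ q ∪ q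
    p⊆pΔq∪q {x} x∈p with x ∈? q
    ... | yes x∈q = x∈p∪q⁺ (inj₂ x∈q)
    ... | no  x∉q = x∈p∪q⁺ (inj₁ (x∈pΔq⁺ (inj₁ (x∈p , x∉q))))

  ∣[p∪q]Δp∣≤∣q∣ : ∀ (p q : Subset n) → ∣ (p ∪ q) Δ p ∣ ≤ ∣ q ∣
  ∣[p∪q]Δp∣≤∣q∣ p q = p⊆q⇒∣p∣≤∣q∣ [p∪q]Δp⊆q
    where
    [p∪q]Δp⊆q : (p ∪ q) Δ p ⊆ q
    [p∪q]Δp⊆q x∈ with x∈pΔq⁻ (p ∪ q) p x∈
    ... | inj₁ (x∈p∪q , x∉p) = [ (λ x∈p → contradiction x∈p x∉p) , id ]′ (x∈p∪q⁻ p q x∈p∪q)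
    ... | inj₂ (x∈p , x∉p∪q) = contradiction (x∈p∪q⁺ (inj₁ x∈p)) x∉p∪q

  private
    pΔr⊆pΔq : p ∩ q ⊆ r → r ⊆ p ∪ q → p Δ r ⊆ p Δ q
    pΔr⊆pΔq {p = p} {q} {r} p∩q⊆r r⊆p∪q x∈ with x∈pΔq⁻ p r x∈
    ... | inj₁ (x∈p , x∉r) = x∈pΔq⁺ (inj₁ (x∈p , λ x∈q → x∉r (p∩q⊆r (x∈p∩q⁺ (x∈p , x∈q)))))
    ... | inj₂ (x∈r , x∉p) = x∈pΔq⁺ (inj₂ ([ (λ x∈p → contradiction x∈p x∉p) , id ]′ (x∈p∪q⁻ p q (r⊆p∪q x∈r)) , x∉p))

  ∣pΔr∣≤∣pΔq∣ : p ∩ q ⊆ r → r ⊆ p ∪ q → ∣ p Δ r ∣ ≤ ∣ p Δ q ∣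
  ∣pΔr∣≤∣pΔq∣ p∩q⊆r r⊆p∪q = p⊆q⇒∣p∣≤∣q∣ (pΔr⊆pΔq p∩q⊆r r⊆p∪q)

  ∣qΔr∣≤∣pΔq∣ : p ∩ q ⊆ r → r ⊆ p ∪ q → ∣ q Δ r ∣ ≤ ∣ p Δ q ∣
  ∣qΔr∣≤∣pΔq∣ {p = p} {q} p∩q⊆r r⊆p∪q = subst (λ s → ∣ q Δ _ ∣ ≤ ∣ s ∣) (Δ-comm q p)
    (∣pΔr∣≤∣pΔq∣ (p∩q⊆r ∘ subst (_ ∈_) (∩-comm q p)) (subst (_ ∈_) (∪-comm p q) ∘ r⊆p∪q))

  ∣p∣+∣q∣≡∣pΔq∣+2*∣p∩q∣ : ∀ (p q : Subset n) → ∣ p ∣ + ∣ q ∣ ≡ ∣ p Δ q ∣ + 2 * ∣ p ∩ q ∣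
  ∣p∣+∣q∣≡∣pΔq∣+2*∣p∩q∣ []            []            = refl
  ∣p∣+∣q∣≡∣pΔq∣+2*∣p∩q∣ (outside ∷ p) (outside ∷ q) = ∣p∣+∣q∣≡∣pΔq∣+2*∣p∩q∣ p q
  ∣p∣+∣q∣≡∣pΔq∣+2*∣p∩q∣ (outside ∷ p) (inside  ∷ q) =
    trans (+-suc ∣ p ∣ ∣ q ∣) (cong suc (∣p∣+∣q∣≡∣pΔq∣+2*∣p∩q∣ p q))
  ∣p∣+∣q∣≡∣pΔq∣+2*∣p∩q∣ (inside  ∷ p) (outside ∷ q) = cong suc (∣p∣+∣q∣≡∣pΔq∣+2*∣p∩q∣ p q)
  ∣p∣+∣q∣≡∣pΔq∣+2*∣p∩q∣ (inside  ∷ p) (inside  ∷ q) = begin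
    suc ∣ p ∣ + suc ∣ q ∣              ≡⟨ cong suc (+-suc ∣ p ∣ ∣ q ∣) ⟩
    2 + (∣ p ∣ + ∣ q ∣)              ≡⟨ cong (2 +_) (∣p∣+∣q∣≡∣pΔq∣+2*∣p∩q∣ p q) ⟩
    2 + (∣ p Δ q ∣ + 2 * ∣ p ∩ q ∣) ≡⟨ sym (+-assoc 2 ∣ p Δ q ∣ _) ⟩
    2 + ∣ p Δ q ∣ + 2 * ∣ p ∩ q ∣   ≡⟨ cong (_+ 2 * ∣ p ∩ q ∣) (+-comm 2 ∣ p Δ q ∣) ⟩
    ∣ p Δ q ∣ + 2 + 2 * ∣ p ∩ q ∣   ≡⟨ +-assoc ∣ p Δ q ∣ 2 _ ⟩
    ∣ p Δ q ∣ + (2 + 2 * ∣ p ∩ q ∣) ≡⟨ cong (∣ p Δ q ∣ +_) (sym (*-suc 2 ∣ p ∩ q ∣)) ⟩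
    ∣ p Δ q ∣ + 2 * suc ∣ p ∩ q ∣    ∎
    where open ≡-Reasoning

  ∣p∣+∣q∣≤∣pΔq∣+2*∣pΔr∣ : ∀ (p q r : Subset n) → Disjoint q r → ∣ p ∣ + ∣ q ∣ ≤ ∣ p Δ q ∣ + 2 * ∣ p Δ r ∣
  ∣p∣+∣q∣≤∣pΔq∣+2*∣pΔr∣ p q r q#r = begin
    ∣ p ∣ + ∣ q ∣                ≡⟨ ∣p∣+∣q∣≡∣pΔq∣+2*∣p∩q∣ p q ⟩
    ∣ p Δ q ∣ + 2 * ∣ p ∩ q ∣  ≤⟨ +-monoʳ-≤ ∣ p Δ q ∣ (*-monoʳ-≤ 2 (p⊆q⇒∣p∣≤∣q∣ p∩q⊆pΔr)) ⟩
    ∣ p Δ q ∣ + 2 * ∣ p Δ r ∣  ∎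
    where
    open ≤-Reasoning
    p∩q⊆pΔr : p ∩ q ⊆ p Δ r
    p∩q⊆pΔr x∈ = let x∈p , x∈q = x∈p∩q⁻ p q x∈ in x∈pΔq⁺ (inj₁ (x∈p , q#r x∈q))

module DisjointFamilies where

  open import Data.Fin using (zero; suc)
  open import Data.Fin.Properties using (0≢1+n; suc-injective)
  open import Data.Fin.Subset using (_∈_)
  open import Data.List using (_∷_; []; length; lookup)
  open import Data.List.Membership.Propositional using () renaming (_∈_ to _∈ₗ_)
  open import Data.List.Membership.Propositional.Properties using (∈-lookup)
  open import Data.List.Relation.Unary.Any using (index)
  open import Data.List.Relation.Unary.Any.Properties using (lookup-index)
  import Data.List.Relation.Unary.All as All
  open import Data.List.Relation.Unary.AllPairs using (AllPairs; []; _∷_)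
  open import Data.Empty using (⊥-elim)
  open import Relation.Binary.PropositionalEquality using (refl; sym; trans; cong; subst)
  open Subsets using (Disjoint)

  private
    variable
      n : ℕ

  DisjointAtIndices : List (Subset n) → Set
  DisjointAtIndices Cs = ∀ (i j : Fin (length Cs)) v → v ∈ lookup Cs i → v ∈ lookup Cs j → i ≡ j

  allPairs⇒disjointAtIndices : ∀ {Cs : List (Subset n)} → AllPairs Disjoint Cs → DisjointAtIndices Cs
  allPairs⇒disjointAtIndices (_ ∷ _)         zero    zero    v _ _ = refl
  allPairs⇒disjointAtIndices (C#Cs ∷ _)      zero    (suc j) v a b = ⊥-elim (All.lookup C#Cs (∈-lookup j) a b)
  allPairs⇒disjointAtIndices (C#Cs ∷ _)      (suc i) zero    v a b = ⊥-elim (All.lookup C#Cs (∈-lookup i) b a)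
  allPairs⇒disjointAtIndices (_ ∷ pairwise) (suc i) (suc j) v a b = cong suc (allPairs⇒disjointAtIndices pairwise i j v a b)

  disjointAtIndices⇒allPairs : ∀ (Cs : List (Subset n)) → DisjointAtIndices Cs → AllPairs Disjoint Cs
  disjointAtIndices⇒allPairs []       _        = []
  disjointAtIndices⇒allPairs (C ∷ Cs) disjoint =
    All.tabulate (λ D∈Cs {v} v∈C v∈D →
      0≢1+n (disjoint zero (suc (index D∈Cs)) v v∈C (subst (v ∈_) (lookup-index D∈Cs) v∈D)))
    ∷ disjointAtIndices⇒allPairs Cs (λ i j v a b → suc-injective (disjoint (suc i) (suc j) v a b))

  disjointAtIndices⇒unique : ∀ {Cs : List (Subset n)} {C D v} → DisjointAtIndices Cs
                           → C ∈ₗ Cs → D ∈ₗ Cs → v ∈ C → v ∈ D → C ≡ D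
  disjointAtIndices⇒unique {Cs = Cs} {v = v} disjoint C∈Cs D∈Cs v∈C v∈D =
    trans (lookup-index C∈Cs)
      (trans (cong (lookup Cs) (disjoint (index C∈Cs) (index D∈Cs) v
                                   (subst (v ∈_) (lookup-index C∈Cs) v∈C) (subst (v ∈_) (lookup-index D∈Cs) v∈D)))
             (sym (lookup-index D∈Cs)))

module RationalArithmetic where

  open import Data.Nat as ℕ using (s≤s; z≤n)
  import Data.Integer as ℤ
  import Data.Integer.Properties as ℤ
  open import Data.Nat.Coprimality using (1-coprimeTo) renaming (sym to coprime-sym)
  open import Data.Bool using (true; false; not; T)
  open import Data.Bool.Properties using (T-≡; T-not-≡; not-injective)
  open import Data.Rational using (_≤_; _<_; _+_; _*_; 0ℚ; 1ℚ; ½; mkℚ; _/_; *≤*; NonNegative; nonNegative)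
  open import Data.Rational.Properties
  open import Data.Rational.Solver using (module +-*-Solver)
  open import Function.Bundles using (module Equivalence)
  open import Function using (_∘_)
  open import Data.Empty using (⊥)
  open import Relation.Binary.PropositionalEquality using (refl; sym; trans; cong; cong₂; subst; subst₂)
  open +-*-Solver using (solve; _:+_; _:*_; con; _:=_)
  open Equivalence using (to; from)

  private
    variable
      m k l : ℕ
      p q r : ℚ

    ⟦⟧≡mkℚ : ∀ m → ⟦ m ⟧ ≡ mkℚ (ℤ.+ m) 0 (coprime-sym (1-coprimeTo m))
    ⟦⟧≡mkℚ m = normalize-coprime (coprime-sym (1-coprimeTo m))

  ⟦⟧-mono-≤ : m ℕ.≤ k → ⟦ m ⟧ ≤ ⟦ k ⟧
  ⟦⟧-mono-≤ {m} {k} m≤k = subst₂ _≤_ (sym (⟦⟧≡mkℚ m)) (sym (⟦⟧≡mkℚ k))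
    (*≤* (subst₂ ℤ._≤_ (sym (ℤ.*-identityʳ (ℤ.+ m))) (sym (ℤ.*-identityʳ (ℤ.+ k))) (ℤ.+≤+ m≤k)))

  ⟦⟧-homo-+ : ∀ m k → ⟦ m ℕ.+ k ⟧ ≡ ⟦ m ⟧ + ⟦ k ⟧
  ⟦⟧-homo-+ m k = sym (trans (cong₂ _+_ (⟦⟧≡mkℚ m) (⟦⟧≡mkℚ k))
    (cong (_/ 1) (cong₂ ℤ._+_ (ℤ.*-identityʳ (ℤ.+ m)) (ℤ.*-identityʳ (ℤ.+ k)))))

  ⟦⟧-≤-+ : ∀ k l → m ℕ.≤ k ℕ.+ l → ⟦ k ⟧ ≤ p → ⟦ l ⟧ ≤ q → ⟦ m ⟧ ≤ p + q
  ⟦⟧-≤-+ k l m≤k+l k≤p l≤q =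
    ≤-trans (⟦⟧-mono-≤ m≤k+l) (subst (_≤ _) (sym (⟦⟧-homo-+ k l)) (+-mono-≤ k≤p l≤q))

  <ᵇ⇒< : p <ᵇ q ≡ true → p < q
  <ᵇ⇒< p<ᵇq = ≰⇒> (λ q≤p → subst T (to T-not-≡ (from T-≡ p<ᵇq)) (≤⇒≤ᵇ q≤p))

  <ᵇ≡false⇒≥ : p <ᵇ q ≡ false → q ≤ p
  <ᵇ≡false⇒≥ p≮ᵇq = ≤ᵇ⇒≤ (from T-≡ (not-injective p≮ᵇq))

  ≥⇒<ᵇ≡false : q ≤ p → p <ᵇ q ≡ false
  ≥⇒<ᵇ≡false q≤p = cong not (to T-≡ (≤⇒≤ᵇ q≤p))

  p≤p+q : 0ℚ ≤ q → p ≤ p + q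
  p≤p+q {q} {p} 0≤q = subst (_≤ p + q) (+-identityʳ p) (+-monoʳ-≤ p 0≤q)

  <⇒≱ : p < q → q ≤ p → ⊥
  <⇒≱ p<q q≤p = <-irrefl refl (<-≤-trans p<q q≤p)

  +-cancelʳ-< : p + r < q + r → p < q
  +-cancelʳ-< {r = r} p+r<q+r = ≰⇒> (<⇒≱ p+r<q+r ∘ +-monoˡ-≤ r)

  p+p≡2p : ∀ p → p + p ≡ ⟦ 2 ⟧ * p
  p+p≡2p = solve 1 (λ f → f :+ f := con ⟦ 2 ⟧ :* f) refl

  module Thresholds (φ η : ℚ) (0≤φ : 0ℚ ≤ φ) (0≤η : 0ℚ ≤ η) where

    φ+φ≤[3+η]φ : φ + φ ≤ (⟦ 3 ⟧ + η) * φ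
    φ+φ≤[3+η]φ = subst (_≤ (⟦ 3 ⟧ + η) * φ) (sym (p+p≡2p φ))
      (*-monoʳ-≤-nonNeg φ {{nonNegative 0≤φ}} (≤-trans (⟦⟧-mono-≤ {2} {3} (s≤s (s≤s z≤n))) (p≤p+q 0≤η)))

    [1+η/2]2φ+φ≡[3+η]φ : (1ℚ + η * ½) * (⟦ 2 ⟧ * φ) + φ ≡ (⟦ 3 ⟧ + η) * φ
    [1+η/2]2φ+φ≡[3+η]φ =
      solve 2 (λ f e → (con 1ℚ :+ e :* con ½) :* (con ⟦ 2 ⟧ :* f) :+ f := (con ⟦ 3 ⟧ :+ e) :* f) refl φ η

    [1+η/2]2φ≤[1+η]2φ : (1ℚ + η * ½) * (⟦ 2 ⟧ * φ) ≤ (1ℚ + η) * (⟦ 2 ⟧ * φ)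
    [1+η/2]2φ≤[1+η]2φ = subst ((1ℚ + η * ½) * (⟦ 2 ⟧ * φ) ≤_) [1+η/2]2φ+ηφ≡[1+η]2φ
      (p≤p+q (nonNegative⁻¹ _ {{ηφ-nonNeg}}))
      where
      ηφ-nonNeg : NonNegative (η * φ)
      ηφ-nonNeg = nonNeg*nonNeg⇒nonNeg η {{nonNegative 0≤η}} φ {{nonNegative 0≤φ}}
      [1+η/2]2φ+ηφ≡[1+η]2φ : (1ℚ + η * ½) * (⟦ 2 ⟧ * φ) + η * φ ≡ (1ℚ + η) * (⟦ 2 ⟧ * φ)
      [1+η/2]2φ+ηφ≡[1+η]2φ =
        solve 2 (λ f e → (con 1ℚ :+ e :* con ½) :* (con ⟦ 2 ⟧ :* f) :+ e :* f := (con 1ℚ :+ e) :* (con ⟦ 2 ⟧ :* f)) refl φ η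

    [1+η]2φ<d : ∀ {a b d} → (⟦ 3 ⟧ + η) * φ < a → (⟦ 3 ⟧ + η) * φ < b → a + b ≤ d + (φ + φ + φ + φ)
              → (1ℚ + η) * (⟦ 2 ⟧ * φ) < d
    [1+η]2φ<d {d = d} bound<a bound<b a+b≤d+4φ = +-cancelʳ-< (begin-strict
      (1ℚ + η) * (⟦ 2 ⟧ * φ) + (φ + φ + φ + φ) ≡⟨ 2·bound≡[1+η]2φ+4φ ⟨
      (⟦ 3 ⟧ + η) * φ + (⟦ 3 ⟧ + η) * φ        <⟨ +-mono-< bound<a bound<b ⟩
      _                                        ≤⟨ a+b≤d+4φ ⟩
      d + (φ + φ + φ + φ)                      ∎)
      where
      open ≤-Reasoning
      2·bound≡[1+η]2φ+4φ : (⟦ 3 ⟧ + η) * φ + (⟦ 3 ⟧ + η) * φ ≡ (1ℚ + η) * (⟦ 2 ⟧ * φ) + (φ + φ + φ + φ)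
      2·bound≡[1+η]2φ+4φ = solve 2 (λ f e → (con ⟦ 3 ⟧ :+ e) :* f :+ (con ⟦ 3 ⟧ :+ e) :* f
                                       := (con 1ℚ :+ e) :* (con ⟦ 2 ⟧ :* f) :+ (f :+ f :+ f :+ f)) refl φ η

module Neighbourhoods {n : ℕ} (G : Graph n) where

  open import Data.Nat using (_≤_; _+_; _*_)
  open import Data.Nat.Properties using (+-mono-≤; +-monoˡ-≤; +-monoʳ-≤; module ≤-Reasoning)
  open import Data.Nat.Solver using (module +-*-Solver)
  open import Data.Fin.Subset using (∣_∣; ⁅_⁆)
  open import Data.Fin.Subset.Properties using (∣q∣≤∣p∪q∣)
  open import Relation.Binary.PropositionalEquality using (refl; cong; subst)
  open Subsets
  open +-*-Solver using (solve; _:+_; _:*_; con; _:=_)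

  N[_]ᴳ : Fin n → Subset n
  N[ u ]ᴳ = N[_] G u

  δ : Fin n → Fin n → ℕ
  δ u v = ∣ N[ u ]ᴳ Δ N[ v ]ᴳ ∣

  deg≤∣N[u]∣ : ∀ u → deg G u ≤ ∣ N[ u ]ᴳ ∣
  deg≤∣N[u]∣ u = ∣q∣≤∣p∪q∣ ⁅ u ⁆ (N G u)

  ρ[u,⁅u⁆]≤deg : ∀ u → ρ G u ⁅ u ⁆ ≤ deg G u
  ρ[u,⁅u⁆]≤deg u = ∣[p∪q]Δp∣≤∣q∣ ⁅ u ⁆ (N G u)

  ρ≤δ+ρ : ∀ x u C → ρ G x C ≤ δ x u + ρ G u C
  ρ≤δ+ρ x u C = ∣pΔq∣≤∣pΔr∣+∣rΔq∣ N[ x ]ᴳ C N[ u ]ᴳ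

  δ≤ρ+ρ : ∀ x y C → δ x y ≤ ρ G x C + ρ G y C
  δ≤ρ+ρ x y C = subst (λ s → δ x y ≤ ρ G x C + ∣ s ∣) (Δ-comm C N[ y ]ᴳ)
                      (∣pΔq∣≤∣pΔr∣+∣rΔq∣ N[ x ]ᴳ N[ y ]ᴳ C)

  δ-comm : ∀ x y → δ x y ≡ δ y x
  δ-comm x y = cong ∣_∣ (Δ-comm N[ x ]ᴳ N[ y ]ᴳ)

  -- N[y] is mostly inside Y and N[h] mostly inside X; since X and Y are disjoint, a
  -- neighbourhood N[x] close to X must be far from N[y].
  deg+deg≤δ+ρ : ∀ {X Y : Subset n} x y h → Disjoint X Y
              → deg G y + deg G h ≤ δ x y + (ρ G x X + ρ G y Y + ρ G y Y + ρ G h X)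
  deg+deg≤δ+ρ {X} {Y} x y h X#Y = begin
    deg G y + deg G h                                ≤⟨ +-mono-≤ (deg≤∣N[u]∣ y) (deg≤∣N[u]∣ h) ⟩
    ∣ N[ y ]ᴳ ∣ + ∣ N[ h ]ᴳ ∣                        ≤⟨ +-monoʳ-≤ ∣ N[ y ]ᴳ ∣ (∣p∣≤∣pΔq∣+∣q∣ N[ h ]ᴳ X) ⟩
    ∣ N[ y ]ᴳ ∣ + (ρ G h X + ∣ X ∣)                ≡⟨ solve 3 (λ a b c → a :+ (b :+ c) := a :+ c :+ b)
                                                          refl (∣ N[ y ]ᴳ ∣) (ρ G h X) (∣ X ∣) ⟩
    ∣ N[ y ]ᴳ ∣ + ∣ X ∣ + ρ G h X                  ≤⟨ +-monoˡ-≤ (ρ G h X) (∣p∣+∣q∣≤∣pΔq∣+2*∣pΔr∣ N[ y ]ᴳ X Y X#Y) ⟩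
    ρ G y X + 2 * ρ G y Y + ρ G h X             ≤⟨ +-monoˡ-≤ (ρ G h X) (+-monoˡ-≤ (2 * ρ G y Y) (ρ≤δ+ρ y x X)) ⟩
    δ y x + ρ G x X + 2 * ρ G y Y + ρ G h X   ≡⟨ cong (λ d → d + ρ G x X + 2 * ρ G y Y + ρ G h X) (δ-comm y x) ⟩
    δ x y + ρ G x X + 2 * ρ G y Y + ρ G h X   ≡⟨ solve 4 (λ d a b c → d :+ a :+ con 2 :* b :+ c := d :+ (a :+ b :+ b :+ c))
                                                          refl (δ x y) (ρ G x X) (ρ G y Y) (ρ G h X) ⟩
    δ x y + (ρ G x X + ρ G y Y + ρ G y Y + ρ G h X) ∎
    where open ≤-Reasoning

module OptimalClustering {n : ℕ} (G : Graph n) (φ : ℚ) (Os : List (Subset n))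
                         (isClustering : IsClustering Os) (obj≤φ : ObjLe G Os φ) where

  open import Data.Rational using (_≤_; _*_)
  open import Data.Fin.Subset using (_∈_; _∉_)
  open import Data.List.Membership.Propositional using () renaming (_∈_ to _∈ₗ_)
  open import Data.Product using (proj₁; proj₂)
  open import Relation.Binary.PropositionalEquality using (sym; subst)
  open Subsets using (Disjoint)
  open DisjointFamilies using (disjointAtIndices⇒unique)
  open RationalArithmetic using (⟦⟧-≤-+; p+p≡2p)
  open Neighbourhoods G

  O : Fin n → Subset n
  O v = proj₁ (proj₁ (proj₂ isClustering) v)

  O∈Os : ∀ v → O v ∈ₗ Os
  O∈Os v = proj₁ (proj₂ (proj₁ (proj₂ isClustering) v))

  v∈Ov : ∀ v → v ∈ O v
  v∈Ov v = proj₂ (proj₂ (proj₁ (proj₂ isClustering) v))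

  x∈Ou⇒Ox≡Ou : ∀ {x u} → x ∈ O u → O x ≡ O u
  x∈Ou⇒Ox≡Ou {x} {u} x∈Ou = disjointAtIndices⇒unique (proj₂ (proj₂ isClustering)) (O∈Os x) (O∈Os u) (v∈Ov x) x∈Ou

  O-sym : ∀ {x u} → x ∈ O u → u ∈ O x
  O-sym {u = u} x∈Ou = subst (u ∈_) (sym (x∈Ou⇒Ox≡Ou x∈Ou)) (v∈Ov u)

  O-trans : ∀ {x y u} → x ∈ O u → y ∈ O x → y ∈ O u
  O-trans {y = y} x∈Ou y∈Ox = subst (y ∈_) (x∈Ou⇒Ox≡Ou x∈Ou) y∈Ox

  y∉Ox⇒disjoint : ∀ {x y} → y ∉ O x → Disjoint (O x) (O y)
  y∉Ox⇒disjoint {y = y} y∉Ox z∈Ox z∈Oy = y∉Ox (O-trans z∈Ox (O-sym z∈Oy))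

  ρ≤φ : ∀ {x u} → x ∈ O u → ⟦ ρ G x (O u) ⟧ ≤ φ
  ρ≤φ {x} {u} x∈Ou = obj≤φ (O∈Os u) x x∈Ou

  δ≤2φ : ∀ {x y c} → x ∈ O c → y ∈ O c → ⟦ δ x y ⟧ ≤ ⟦ 2 ⟧ * φ
  δ≤2φ {x} {y} {c} x∈Oc y∈Oc = subst (⟦ δ x y ⟧ ≤_) (p+p≡2p φ)
    (⟦⟧-≤-+ (ρ G x (O c)) (ρ G y (O c)) (δ≤ρ+ρ x y (O c)) (ρ≤φ x∈Oc) (ρ≤φ y∈Oc))

module Execution {n : ℕ} (G : Graph n) (φ η : ℚ) where

  open import Data.Bool using (true; false; _∧_; if_then_else_; _≟_)
  open import Data.Bool.ListAction using (any)
  open import Data.Maybe using (nothing)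
  open import Data.Bool.Properties using (not-injective)
  open import Data.Fin.Subset using (_∈_; _⊆_; _∪_; _─_; ⁅_⁆; Nonempty)
  open import Data.Fin.Subset.Properties using (x∈p∪q⁻; x∈p∪q⁺; p─q⊆p; x∈p∧x∉q⇒x∈p─q; _∈?_; x∈⁅x⁆; x∈⁅y⁆⇒x≡y)
  open import Data.Vec using (lookup)
  open import Data.Vec.Properties using ([]=⇒lookup; lookup⇒[]=)
  open import Data.List using (_∷_; []; _++_; allFin)
  open import Data.List.Relation.Unary.Any using (Any; here; there)
  open import Data.List.Relation.Unary.All as All using (All; []; _∷_)
  open import Data.List.Relation.Unary.AllPairs using (AllPairs; []; _∷_)
  import Data.List.Relation.Unary.AllPairs.Properties as AllPairs
  open import Data.List.Membership.Propositional using (find) renaming (_∈_ to _∈ₗ_)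
  open import Data.List.Membership.Propositional.Properties using (∈-map⁺; ∈-map⁻; ∈-filter⁺; ∈-filter⁻; ∈-allFin; ∈-++⁺ˡ; ∈-++⁺ʳ; ∈-++⁻)
  open import Data.Product using (_,_; proj₁; proj₂)
  open import Data.Sum using (_⊎_; inj₁; inj₂; [_,_]′)
  import Data.Sum as Sum
  open import Function using (_∘_; id; _on_)
  open import Relation.Nullary using (yes; no)
  open import Relation.Binary.PropositionalEquality using (refl; sym; trans; cong; cong₂; subst)
  open import Data.Rational using (_≤_; _<_; _+_; _*_; 1ℚ)
  open import Data.Rational.Properties using (≤-trans; ≮⇒≥)
  open import Relation.Nullary using (contradiction)
  open Subsets
  open DisjointFamilies using (allPairs⇒disjointAtIndices)
  open Neighbourhoods G using (δ; ρ[u,⁅u⁆]≤deg)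
  open RationalArithmetic using (⟦⟧-mono-≤; <ᵇ⇒<; <ᵇ≡false⇒≥; ≥⇒<ᵇ≡false; <⇒≱)
  open ClusterPhi G φ η

  query-true⇒≤ : ∀ {η′ t q} → IsQuery G η′ t q → ∀ {u v} → q u v ≡ true → ⟦ δ u v ⟧ ≤ (1ℚ + η′) * t
  query-true⇒≤ isQuery {u} {v} quv = ≮⇒≥ (λ far → contradiction (trans (sym quv) (proj₂ (isQuery u v) far)) λ ())


  ∧≡false : ∀ {a b} → (a ≡ true → b ≡ false) → a ∧ b ≡ false
  ∧≡false {true}  b≡false = b≡false refl
  ∧≡false {false} _       = refl

  any≡false : ∀ {A : Set} {f : A → Bool} {xs} → All (λ x → f x ≡ false) xs → any f xs ≡ false
  any≡false []                  = refl
  any≡false (fx≡false ∷ fxs≡false) rewrite fx≡false = any≡false fxs≡false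

  Vhigh⇒bound<deg : ∀ {w} → w ∈ Vhigh → bound < ⟦ deg G w ⟧
  Vhigh⇒bound<deg w∈Vhigh = <ᵇ⇒< (x∈tabulate⁻ w∈Vhigh)

  Vlow⇒deg≤bound : ∀ {w} → w ∈ Vlow → ⟦ deg G w ⟧ ≤ bound
  Vlow⇒deg≤bound w∈Vlow = <ᵇ≡false⇒≥ (not-injective (x∈tabulate⁻ w∈Vlow))

  Vhigh⊎Vlow : ∀ w → w ∈ Vhigh ⊎ w ∈ Vlow
  Vhigh⊎Vlow = x∈tabulate⊎x∈tabulate[not] high

  Vhigh#Vlow : Disjoint Vhigh Vlow
  Vhigh#Vlow w∈Vhigh w∈Vlow = <⇒≱ (Vhigh⇒bound<deg w∈Vhigh) (Vlow⇒deg≤bound w∈Vlow)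

  Pending : Subset n → List (Subset n × Fin n) → Fin n → Set
  Pending V exec x = x ∈ V ⊎ Any (λ e → x ∈ proj₁ e) exec

  _⊆Pending_,_ : Subset n → Subset n → List (Subset n × Fin n) → Set
  C ⊆Pending V , exec = ∀ {x} → x ∈ C → Pending V exec x

  module Loop (q2 : Fin n → Fin n → Bool) where

    clusters : Subset n → List (Subset n × Fin n) → List (Subset n)
    clusters V exec = proj₁ (loop q2 V exec)

    leftover : Subset n → List (Subset n × Fin n) → Subset n
    leftover V exec = proj₂ (loop q2 V exec)

    ∈R⁻ : ∀ {u V w} → w ∈ R q2 u V → w ∈ V × w ∈ N G u × q2 w u ≡ true
    ∈R⁻ {u} {V} {w} w∈R =
      let w∈V , rest = ∧-≡true⁻ (x∈tabulate⁻ w∈R) ; u~w , q2wu = ∧-≡true⁻ rest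
      in lookup⇒[]= w V w∈V , x∈tabulate⁺ u~w , q2wu
      where
      ∧-≡true⁻ : ∀ {a b} → a ∧ b ≡ true → a ≡ true × b ≡ true
      ∧-≡true⁻ {true} b≡true = refl , b≡true

    ∈R⁺ : ∀ {u V w} → w ∈ V → w ∈ N G u → q2 w u ≡ true → w ∈ R q2 u V
    ∈R⁺ {u} {V} {w} w∈V w∈Nu q2wu = x∈tabulate⁺ (cong₂ _∧_ ([]=⇒lookup w∈V) (cong₂ _∧_ (x∈tabulate⁻ w∈Nu) q2wu))

    R⊆V : ∀ {u V} → R q2 u V ⊆ V
    R⊆V = proj₁ ∘ ∈R⁻

    record Splits (V : Subset n) (exec : List (Subset n × Fin n)) : Set where
      field
        clusters-disjoint : AllPairs Disjoint (clusters V exec)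
        clusters#leftover : All (λ C → Disjoint C (leftover V exec)) (clusters V exec)
        leftover⊆V        : leftover V exec ⊆ V
        clusters⊆pending  : All (_⊆Pending V , exec) (clusters V exec)
        pending⊆          : ∀ {x} → Pending V exec x → Any (x ∈_) (clusters V exec) ⊎ x ∈ leftover V exec

    splits : ∀ V exec → AllPairs (Disjoint on proj₁) exec → All (λ e → Disjoint (proj₁ e) V) exec → Splits V exec
    splits V [] _ _ = record
      { clusters-disjoint = []
      ; clusters#leftover = []
      ; leftover⊆V        = id
      ; clusters⊆pending  = []
      ; pending⊆          = [ inj₂ , (λ ()) ]′
      }
    splits V ((L , u) ∷ exec) (L#exec ∷ exec-disjoint) (L#V ∷ exec#V) = record
      { clusters-disjoint = All.map C#D (clusters⊆pending IH) ∷ clusters-disjoint IH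
      ; clusters#leftover = (λ x∈C x∈Vk → C#V′ x∈C (leftover⊆V IH x∈Vk)) ∷ clusters#leftover IH
      ; leftover⊆V        = V′⊆V ∘ leftover⊆V IH
      ; clusters⊆pending  = C⊆pending ∷ All.map (λ D⊆pending {x} x∈D → Sum.map V′⊆V there (D⊆pending x∈D))
                                                (clusters⊆pending IH)
      ; pending⊆          = pending⊆′
      }
      where
      open Splits
      Rᵤ = R q2 u V
      V′ = V ─ Rᵤ
      C = L ∪ Rᵤ

      V′⊆V : V′ ⊆ V
      V′⊆V = p─q⊆p V Rᵤ

      IH : Splits V′ exec
      IH = splits V′ exec exec-disjoint (All.map (λ L#V {x} x∈L x∈V′ → L#V x∈L (V′⊆V x∈V′)) exec#V)

      C#V′ : Disjoint C V′
      C#V′ x∈C x∈V′ = [ (λ x∈L → L#V x∈L (V′⊆V x∈V′)) , x∈p─q⇒x∉q V Rᵤ x∈V′ ]′ (x∈p∪q⁻ L Rᵤ x∈C)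

      C#D : ∀ {D} → D ⊆Pending V′ , exec → Disjoint C D
      C#D D⊆pending x∈C x∈D with D⊆pending x∈D
      ... | inj₁ x∈V′   = C#V′ x∈C x∈V′
      ... | inj₂ x∈exec = [ (λ x∈L → All.lookupWith (λ L#L′ x∈L′ → L#L′ x∈L x∈L′) L#exec x∈exec)
                          , (λ x∈R → All.lookupWith (λ L′#V x∈L′ → L′#V x∈L′ (R⊆V x∈R)) exec#V x∈exec) ]′
                          (x∈p∪q⁻ L Rᵤ x∈C)

      C⊆pending : C ⊆Pending V , ((L , u) ∷ exec)
      C⊆pending x∈C = [ inj₂ ∘ here , inj₁ ∘ R⊆V ]′ (x∈p∪q⁻ L Rᵤ x∈C)

      pending⊆′ : ∀ {x} → Pending V ((L , u) ∷ exec) x → Any (x ∈_) (C ∷ clusters V′ exec) ⊎ x ∈ leftover V′ exec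
      pending⊆′ (inj₂ (here x∈L))    = inj₁ (here (x∈p∪q⁺ (inj₁ x∈L)))
      pending⊆′ (inj₂ (there x∈exec)) = Sum.map₁ there (pending⊆ IH (inj₂ x∈exec))
      pending⊆′ {x} (inj₁ x∈V) with x ∈? Rᵤ
      ... | yes x∈R = inj₁ (here (x∈p∪q⁺ (inj₂ x∈R)))
      ... | no  x∉R = Sum.map₁ there (pending⊆ IH (inj₁ (x∈p∧x∉q⇒x∈p─q x∈V x∉R)))

    Good : Subset n → Set
    Good C = ∀ u → u ∈ C → ⟦ ρ G u C ⟧ ≤ bound

    good⇒¬bad : ∀ {C} → Good C → bad q2 C ≡ false
    good⇒¬bad {C} good = any≡false (All.universal passes (allFin n))
      where
      passes : ∀ u → lookup C u ∧ (bound <ᵇ ⟦ ρ G u C ⟧) ≡ false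
      passes u = ∧≡false (λ C[u] → ≥⇒<ᵇ≡false (good u (lookup⇒[]= u C C[u])))

    clusterPhi≡just : ∀ exec → All Good (clusters Vlow exec)
                    → clusterPhi q2 exec ≡ just (clusters Vlow exec ++ singletons q2 (leftover Vlow exec))
    clusterPhi≡just exec goods =
      cong (λ b → if b then nothing else just (clusters Vlow exec ++ singletons q2 (leftover Vlow exec)))
           (any≡false (All.map good⇒¬bad goods))

    ∈-singletons⁻ : ∀ {S C} → C ∈ₗ singletons q2 S → ∃ λ w → w ∈ S × C ≡ ⁅ w ⁆
    ∈-singletons⁻ {S} C∈ with ∈-map⁻ ⁅_⁆ C∈
    ... | w , w∈filter , refl = w , lookup⇒[]= w S (proj₂ (∈-filter⁻ (λ v → lookup S v ≟ true) {xs = allFin n} w∈filter)) , refl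

    ∈-singletons⁺ : ∀ {S w} → w ∈ S → ⁅ w ⁆ ∈ₗ singletons q2 S
    ∈-singletons⁺ {S} {w} w∈S = ∈-map⁺ ⁅_⁆ (∈-filter⁺ (λ v → lookup S v ≟ true) (∈-allFin w) ([]=⇒lookup w∈S))

    singletons-disjoint : ∀ S → AllPairs Disjoint (singletons q2 S)
    singletons-disjoint S = AllPairs.map⁺ (AllPairs.filter⁺ (λ v → lookup S v ≟ true) (AllPairs.tabulate⁺ {f = id}
      (λ i≢j x∈⁅i⁆ x∈⁅j⁆ → i≢j (trans (sym (x∈⁅y⁆⇒x≡y _ x∈⁅i⁆)) (x∈⁅y⁆⇒x≡y _ x∈⁅j⁆)))))

    ++singletons-isClustering : ∀ {Cs S} → All Nonempty Cs → AllPairs Disjoint Cs → All (λ C → Disjoint C S) Cs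
                              → (∀ v → Any (v ∈_) Cs ⊎ v ∈ S) → IsClustering (Cs ++ singletons q2 S)
    ++singletons-isClustering {Cs} {S} nonempty disjoint apart cover =
      nonempty′ , cover′ , allPairs⇒disjointAtIndices disjoint′
      where
      nonempty′ : ∀ {C} → C ∈ₗ Cs ++ singletons q2 S → Nonempty C
      nonempty′ C∈ with ∈-++⁻ Cs C∈
      ... | inj₁ C∈Cs = All.lookup nonempty C∈Cs
      ... | inj₂ C∈Ss with ∈-singletons⁻ {S} C∈Ss
      ...   | w , _ , refl = w , x∈⁅x⁆ w

      cover′ : ∀ v → ∃ λ C → C ∈ₗ Cs ++ singletons q2 S × v ∈ C
      cover′ v with cover v
      ... | inj₁ v∈Cs = let C , C∈Cs , v∈C = find v∈Cs in C , ∈-++⁺ˡ C∈Cs , v∈C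
      ... | inj₂ v∈S  = ⁅ v ⁆ , ∈-++⁺ʳ Cs (∈-singletons⁺ v∈S) , x∈⁅x⁆ v

      C#singletons : ∀ {C} → Disjoint C S → All (Disjoint C) (singletons q2 S)
      C#singletons C#S = All.tabulate λ D∈Ss x∈C x∈D →
        let w , w∈S , D≡⁅w⁆ = ∈-singletons⁻ {S} D∈Ss
        in C#S x∈C (subst (_∈ S) (sym (x∈⁅y⁆⇒x≡y w (subst (_ ∈_) D≡⁅w⁆ x∈D))) w∈S)

      disjoint′ : AllPairs Disjoint (Cs ++ singletons q2 S)
      disjoint′ = AllPairs.++⁺ disjoint (singletons-disjoint S) (All.map C#singletons apart)

    clusters-nonempty : ∀ V exec → All (λ e → proj₂ e ∈ proj₁ e) exec → All Nonempty (clusters V exec)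
    clusters-nonempty V []               []               = []
    clusters-nonempty V ((L , u) ∷ exec) (u∈L ∷ pivots∈) = (u , x∈p∪q⁺ (inj₁ u∈L)) ∷ clusters-nonempty _ exec pivots∈

    singletons-good : ∀ {S} → S ⊆ Vlow → All Good (singletons q2 S)
    singletons-good {S} S⊆Vlow = All.tabulate λ C∈ → singleton-good (∈-singletons⁻ {S} C∈)
      where
      singleton-good : ∀ {C} → ∃ (λ w → w ∈ S × C ≡ ⁅ w ⁆) → Good C
      singleton-good (w , w∈S , refl) x x∈⁅w⁆ = subst (λ y → ⟦ ρ G y ⁅ w ⁆ ⟧ ≤ bound) (sym (x∈⁅y⁆⇒x≡y w x∈⁅w⁆))
        (≤-trans (⟦⟧-mono-≤ (ρ[u,⁅u⁆]≤deg w)) (Vlow⇒deg≤bound (S⊆Vlow w∈S)))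

open import Data.Rational using (_≤_; _<_; _*_; _+_; 0ℚ; 1ℚ; ½)

module Correctness {n : ℕ} (G : Graph n) (φ η : ℚ) (0≤φ : 0ℚ ≤ φ) (0≤η : 0ℚ ≤ η)
                   (Os : List (Subset n)) (isClustering : IsClustering Os) (obj≤φ : ObjLe G Os φ)
                   (q1 q2 : Fin n → Fin n → Bool)
                   (isQuery1 : IsQuery G η (ClusterPhi.twoφ G φ η) q1)
                   (isQuery2 : IsQuery G (η * ½) (ClusterPhi.twoφ G φ η) q2) where

  open import Data.Nat as ℕ using ()
  import Data.Nat.Properties as ℕ
  open import Data.Bool using (true)
  open import Data.Fin.Subset using (_∈_; _∉_; _⊆_; _∪_; _∩_; _─_; ⁅_⁆; ∣_∣)
  open import Data.Fin.Subset.Properties using (x∈p∪q⁻; x∈p∪q⁺; x∈p∩q⁻; p─q⊆p; x∈p∧x∉q⇒x∈p─q; _∈?_; x∈⁅y⁆⇒x≡y)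
  open import Data.List using (_∷_; [])
  open import Data.List.Relation.Unary.All as All using (All; []; _∷_)
  open import Data.List.Relation.Unary.AllPairs using (AllPairs; []; _∷_)
  open import Data.Product using (_,_; proj₁; proj₂; uncurry)
  open import Data.Sum using (inj₁; inj₂; [_,_]′)
  open import Function using (_∘_; _on_)
  open import Relation.Nullary using (contradiction)
  open import Relation.Nullary.Decidable using (decidable-stable)
  open import Relation.Binary.PropositionalEquality using (sym; subst)
  open import Data.Rational.Properties using (≤-refl; ≤-trans)
  open Subsets
  open RationalArithmetic
  open Thresholds φ η 0≤φ 0≤η
  open Neighbourhoods G
  open OptimalClustering G φ Os isClustering obj≤φ
  open ClusterPhi G φ η
  open Execution G φ η
  open Loop q2

  q1≡true⇒close : ∀ {v w} → q1 v w ≡ true → ⟦ δ v w ⟧ ≤ (1ℚ + η) * twoφ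
  q1≡true⇒close = query-true⇒≤ {η} {twoφ} isQuery1

  q2≡true⇒close : ∀ {v w} → q2 v w ≡ true → ⟦ δ v w ⟧ ≤ (1ℚ + η * ½) * twoφ
  q2≡true⇒close = query-true⇒≤ {η * ½} {twoφ} isQuery2

  far-apart : ∀ {x h y} → x ∈ O h → h ∈ Vhigh → y ∈ Vhigh → y ∉ O h → (1ℚ + η) * twoφ < ⟦ δ x y ⟧
  far-apart {x} {h} {y} x∈Oh h∈Vhigh y∈Vhigh y∉Oh =
    [1+η]2φ<d (Vhigh⇒bound<deg y∈Vhigh) (Vhigh⇒bound<deg h∈Vhigh)
      (subst (_≤ ⟦ δ x y ⟧ + (φ + φ + φ + φ)) (⟦⟧-homo-+ (deg G y) (deg G h))
        (⟦⟧-≤-+ (δ x y) ρs (deg+deg≤δ+ρ x y h (y∉Ox⇒disjoint y∉Oh)) ≤-refl ρs≤4φ))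
    where
    ρx = ρ G x (O h)
    ρy = ρ G y (O y)
    ρh = ρ G h (O h)
    ρs = ρx ℕ.+ ρy ℕ.+ ρy ℕ.+ ρh
    ρs≤4φ : ⟦ ρs ⟧ ≤ φ + φ + φ + φ
    ρs≤4φ = ⟦⟧-≤-+ (ρx ℕ.+ ρy ℕ.+ ρy) ρh ℕ.≤-refl
              (⟦⟧-≤-+ (ρx ℕ.+ ρy) ρy ℕ.≤-refl (⟦⟧-≤-+ ρx ρy ℕ.≤-refl (ρ≤φ x∈Oh) (ρ≤φ (v∈Ov y))) (ρ≤φ (v∈Ov y)))
              (ρ≤φ (v∈Ov h))

  close⇒∈O : ∀ {x h y} → x ∈ O h → h ∈ Vhigh → y ∈ Vhigh → ⟦ δ x y ⟧ ≤ (1ℚ + η) * twoφ → y ∈ O h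
  close⇒∈O {x} {h} {y} x∈Oh h∈Vhigh y∈Vhigh close =
    decidable-stable (y ∈? O h) (λ y∉Oh → <⇒≱ (far-apart x∈Oh h∈Vhigh y∈Vhigh y∉Oh) close)

  Conn⇒Vhigh : ∀ {a b} → Conn q1 a b → b ∈ Vhigh
  Conn⇒Vhigh (conn-refl b∈Vhigh)     = b∈Vhigh
  Conn⇒Vhigh (conn-step _ b∈Vhigh _) = b∈Vhigh

  Conn⇒∈O : ∀ {a b} → Conn q1 a b → b ∈ O a
  Conn⇒∈O {a} (conn-refl _)                 = v∈Ov a
  Conn⇒∈O {a} (conn-step {v = v} {w} a~v w∈Vhigh q1vw) =
    O-trans (Conn⇒∈O a~v) (close⇒∈O (v∈Ov v) (Conn⇒Vhigh a~v) w∈Vhigh (q1≡true⇒close q1vw))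

  record Component (L : Subset n) (u : Fin n) : Set where
    field
      pivot∈    : u ∈ L
      ⊆Vhigh    : L ⊆ Vhigh
      ⊆O        : L ⊆ O u
      Vhigh∩O⊆ : ∀ {v} → v ∈ Vhigh → v ∈ O u → v ∈ L
  open Component

  Component⇒#Vlow : ∀ {L u} → Component L u → Disjoint L Vlow
  Component⇒#Vlow comp x∈L = Vhigh#Vlow (⊆Vhigh comp x∈L)

  validExec⇒components : ∀ {exec} → ValidExec q1 exec → All (uncurry Component) exec
  validExec⇒components (pivot∈L , L⊆Vhigh , L-connected , L-closed , _) = All.tabulate λ {(L , u)} e∈ → record
    { pivot∈    = pivot∈L e∈
    ; ⊆Vhigh    = L⊆Vhigh e∈ _
    ; ⊆O        = λ {v} v∈L → Conn⇒∈O (L-connected e∈ u v (pivot∈L e∈) v∈L)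
    ; Vhigh∩O⊆ = λ {v} v∈Vhigh v∈Ou → L-closed e∈ u v (pivot∈L e∈)
        (conn-step (conn-refl (L⊆Vhigh e∈ u (pivot∈L e∈))) v∈Vhigh (proj₁ (isQuery1 u v) (δ≤2φ (v∈Ov u) v∈Ou)))
    }

  LowsOfClusterIn : Subset n → Subset n × Fin n → Set
  LowsOfClusterIn V e = ∀ {w} → w ∈ Vlow → w ∈ O (proj₂ e) → w ∈ V

  -- This is why the loop never removes a low vertex that a later pivot needs.
  R-avoids-other-clusters : ∀ {L u L′ u′ V w} → Component L u → Component L′ u′ → Disjoint L L′
                          → w ∈ O u′ → w ∉ R q2 u V
  R-avoids-other-clusters {u = u} {u′ = u′} {V} {w} comp comp′ L#L′ w∈Ou′ w∈R =
    L#L′ (Vhigh∩O⊆ comp u′∈Vhigh (O-sym u∈Ou′)) (pivot∈ comp′)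
    where
    u′∈Vhigh = ⊆Vhigh comp′ (pivot∈ comp′)
    u∈Ou′ : u ∈ O u′
    u∈Ou′ = close⇒∈O w∈Ou′ u′∈Vhigh (⊆Vhigh comp (pivot∈ comp))
              (≤-trans (q2≡true⇒close (proj₂ (proj₂ (∈R⁻ {u} {V} w∈R)))) [1+η/2]2φ≤[1+η]2φ)

  L∪R-good : ∀ {L u V} → Component L u → V ⊆ Vlow → LowsOfClusterIn V (L , u) → Good (L ∪ R q2 u V)
  L∪R-good {L} {u} {V} comp V⊆Vlow lows⊆V x x∈C = [ via-O , via-N[u] ]′ (x∈p∪q⁻ L Rᵤ x∈C)
    where
    Rᵤ = R q2 u V
    C = L ∪ Rᵤ

    C⊆N[u]∪O : C ⊆ N[ u ]ᴳ ∪ O u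
    C⊆N[u]∪O y∈C = [ (λ y∈L → x∈p∪q⁺ (inj₂ (⊆O comp y∈L)))
                   , (λ y∈R → x∈p∪q⁺ (inj₁ (x∈p∪q⁺ (inj₂ (proj₁ (proj₂ (∈R⁻ {u} {V} y∈R))))))) ]′
                   (x∈p∪q⁻ L Rᵤ y∈C)

    N[u]∩O⊆C : N[ u ]ᴳ ∩ O u ⊆ C
    N[u]∩O⊆C {y} y∈ = [ y∈C-if-high , y∈C-if-low ]′ (Vhigh⊎Vlow y)
      where
      y∈N[u] = proj₁ (x∈p∩q⁻ N[ u ]ᴳ (O u) y∈)
      y∈Ou = proj₂ (x∈p∩q⁻ N[ u ]ᴳ (O u) y∈)
      y∈C-if-high : y ∈ Vhigh → y ∈ C
      y∈C-if-high y∈Vhigh = x∈p∪q⁺ (inj₁ (Vhigh∩O⊆ comp y∈Vhigh y∈Ou))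
      y∈C-if-low : y ∈ Vlow → y ∈ C
      y∈C-if-low y∈Vlow = [ (λ y∈⁅u⁆ → contradiction y∈⁅u⁆ y∉⁅u⁆) , y∈Nu⇒y∈C ]′ (x∈p∪q⁻ ⁅ u ⁆ (N G u) y∈N[u])
        where
        y∉⁅u⁆ : y ∉ ⁅ u ⁆
        y∉⁅u⁆ y∈⁅u⁆ = Vhigh#Vlow (subst (_∈ Vhigh) (sym (x∈⁅y⁆⇒x≡y u y∈⁅u⁆)) (⊆Vhigh comp (pivot∈ comp))) y∈Vlow
        y∈Nu⇒y∈C : y ∈ N G u → y ∈ C
        y∈Nu⇒y∈C y∈Nu =
          x∈p∪q⁺ (inj₂ (∈R⁺ {u} (lows⊆V y∈Vlow y∈Ou) y∈Nu (proj₁ (isQuery2 y u) (δ≤2φ y∈Ou (v∈Ov u)))))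

    ⟦ρ[u,C]⟧≤φ : ⟦ ρ G u C ⟧ ≤ φ
    ⟦ρ[u,C]⟧≤φ = ≤-trans (⟦⟧-mono-≤ (∣pΔr∣≤∣pΔq∣ N[u]∩O⊆C C⊆N[u]∪O)) (ρ≤φ (v∈Ov u))

    ⟦∣OΔC∣⟧≤φ : ⟦ ∣ O u Δ C ∣ ⟧ ≤ φ
    ⟦∣OΔC∣⟧≤φ = ≤-trans (⟦⟧-mono-≤ (∣qΔr∣≤∣pΔq∣ N[u]∩O⊆C C⊆N[u]∪O)) (ρ≤φ (v∈Ov u))

    via-O : x ∈ L → ⟦ ρ G x C ⟧ ≤ bound
    via-O x∈L = ≤-trans
      (⟦⟧-≤-+ (ρ G x (O u)) ∣ O u Δ C ∣ (∣pΔq∣≤∣pΔr∣+∣rΔq∣ N[ x ]ᴳ C (O u)) (ρ≤φ (⊆O comp x∈L)) ⟦∣OΔC∣⟧≤φ)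
      φ+φ≤[3+η]φ

    via-N[u] : x ∈ Rᵤ → ⟦ ρ G x C ⟧ ≤ bound
    via-N[u] x∈R = subst (⟦ ρ G x C ⟧ ≤_) [1+η/2]2φ+φ≡[3+η]φ
      (⟦⟧-≤-+ (δ x u) (ρ G u C) (ρ≤δ+ρ x u C) (q2≡true⇒close (proj₂ (proj₂ (∈R⁻ {u} {V} x∈R)))) ⟦ρ[u,C]⟧≤φ)

  clusters-good : ∀ V exec → V ⊆ Vlow → All (LowsOfClusterIn V) exec → All (uncurry Component) exec
                → AllPairs (Disjoint on proj₁) exec → All Good (clusters V exec)
  clusters-good V []               _      _                   _               _                    = []
  clusters-good V ((L , u) ∷ exec) V⊆Vlow (lows⊆V ∷ lows⊆V*) (comp ∷ comps) (L#exec ∷ exec-disjoint) =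
    L∪R-good comp V⊆Vlow lows⊆V ∷ clusters-good V′ exec (V⊆Vlow ∘ p─q⊆p V Rᵤ) lows⊆V′ comps exec-disjoint
    where
    Rᵤ = R q2 u V
    V′ = V ─ Rᵤ
    lows⊆V′ : All (LowsOfClusterIn V′) exec
    lows⊆V′ = All.tabulate λ e∈ w∈Vlow w∈Ou′ →
      x∈p∧x∉q⇒x∈p─q (All.lookup lows⊆V* e∈ w∈Vlow w∈Ou′)
                    (R-avoids-other-clusters {V = V} comp (All.lookup comps e∈) (All.lookup L#exec e∈) w∈Ou′)

open import Data.Fin.Subset using (_∈_)
open import Data.List using (_++_; map)
open import Data.List.Membership.Propositional using (lose)
open import Data.List.Relation.Unary.Any using (Any)
import Data.List.Relation.Unary.All as All
open import Data.List.Relation.Unary.All.Properties using (++⁺)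
open import Data.List.Relation.Unary.AllPairs using (AllPairs)
import Data.List.Relation.Unary.AllPairs.Properties as AllPairs
open import Data.Product using (_,_; proj₁)
open import Data.Sum using (_⊎_; inj₁; inj₂; [_,_]′)
open import Function using (id; _on_)
open Subsets using (Disjoint)
open DisjointFamilies using (disjointAtIndices⇒allPairs)

mainTheorem1 : ∀ {n : ℕ} (G : Graph n) (φ η : ℚ)
    → 0ℚ ≤ φ → 0ℚ ≤ η → η < 1ℚ
    → OPT≤ G φ
    → (q1 q2 : Fin n → Fin n → Bool)
    → IsQuery G η (ClusterPhi.twoφ G φ η) q1
    → (∀ u v → q1 u v ≡ q1 v u)
    → IsQuery G (η * ½) (ClusterPhi.twoφ G φ η) q2
    → (exec : List (Subset n × Fin n))
    → ClusterPhi.ValidExec G φ η q1 exec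
    → ∃ λ Cs → (ClusterPhi.clusterPhi G φ η q2 exec ≡ just Cs)
             × IsClustering Cs
             × ObjLe G Cs ((⟦ 3 ⟧ + η) * φ)
mainTheorem1 G φ η 0≤φ 0≤η _ (Os , isClustering , obj≤φ) q1 q2 isQuery1 _ isQuery2 exec
             validExec@(_ , _ , _ , _ , Vhigh⊆components , components-disjoint) =
  Cs ++ singletons q2 Vk , clusterPhi≡just exec goods , isClustering′ , obj
  where
  open ClusterPhi G φ η
  open Correctness G φ η 0≤φ 0≤η Os isClustering obj≤φ q1 q2 isQuery1 isQuery2
  open Execution G φ η
  open Loop q2
  open Splits

  comps = validExec⇒components validExec

  disjoint : AllPairs (Disjoint on proj₁) exec
  disjoint = AllPairs.map⁻ (disjointAtIndices⇒allPairs (map proj₁ exec) components-disjoint)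

  Cs = clusters Vlow exec
  Vk = leftover Vlow exec
  split = splits Vlow exec disjoint (All.map Component⇒#Vlow comps)
  goods = clusters-good Vlow exec id (All.universal (λ _ {w} w∈Vlow _ → w∈Vlow) exec) comps disjoint

  covered : ∀ v → Any (v ∈_) Cs ⊎ v ∈ Vk
  covered v = pending⊆ split ([ (λ v∈Vhigh → let _ , _ , e∈ , v∈L = Vhigh⊆components v v∈Vhigh in inj₂ (lose e∈ v∈L))
                              , inj₁ ]′ (Vhigh⊎Vlow v))

  isClustering′ = ++singletons-isClustering (clusters-nonempty Vlow exec (All.map Component.pivot∈ comps))
                                            (clusters-disjoint split) (clusters#leftover split) covered

  obj : ObjLe G (Cs ++ singletons q2 Vk) bound
  obj = All.lookup (++⁺ goods (singletons-good (leftover⊆V split)))
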